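{- Let $n$ be a positive integer and let $\mathcal{M}_{n,2}$ be the class of matroids of rank at most $2$ with at most $n$ elements. There is an online matroid morphism from $\mathcal{M}_{n,2}$ into $\mathbf{U}_{n,2}\oplus\mathbf{T}$.
   Context: $\mathbf{U}_{n,2}\oplus\mathbf{T}$ is the matroid with ground set $\{0,1,\dots,n\}$ whose independent sets are the subsets with at most $2$ elements not containing $0$ (it is the direct sum of the uniform matroid of rank $2$ on $[n]$ and the one-element matroid whose element is a loop). A morphism $f:\mathbf{M}\to\mathbf{N}$ is a map of ground sets with $\mathrm{rank}_{\mathbf{N}}(f(S))=\mathrm{rank}_{\mathbf{M}}(S)$ for all $S$. An ordering of $\mathbf{M}$ with $|\mathbf{M}|=m$ is a bijection $\pi:[m]\to\mathbf{M}$; for $m'<m$ the prefix-restriction $(\mathbf{M}',\pi')$ is the restriction of $\mathbf{M}$ to $\pi([m'])$ with $\pi'=\pi|_{[m']}$. An online matroid morphism of $\mathcal{C}$ into $\mathbf{BigM}$ is a family of morphisms $f_{\mathbf{M},\pi}:\mathbf{M}\to\mathbf{BigM}$ for all $\mathbf{M}\in\mathcal{C}$ and orderings $\pi$, such that for every prefix-restriction $(\mathbf{M}',\pi')$ of $(\mathbf{M},\pi)$, $f_{\mathbf{M}',\pi'}$ is the restriction of $f_{\mathbf{M},\pi}$ to $\mathbf{M}'$. -}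

module Defs where

open import Data.Nat using (ℕ; zero; suc; _+_; _≤_; _<_)
open import Data.Bool using (Bool; true; false; if_then_else_)
open import Data.Fin using (Fin; zero; suc; _↑ˡ_)
open import Data.Fin.Subset using (Subset; ⊥; ⁅_⁆; _∪_; _∈_; _∉_; _⊆_; ∣_∣)
open import Data.Vec using (Vec; []; _∷_; _++_; replicate)
open import Data.Product using (Σ; _×_; ∃; _,_)
open import Relation.Nullary using (Dec; ¬?)
open import Relation.Nullary.Decidable using (_×-dec_)
open import Data.Fin.Subset.Properties using (_∈?_)
open import Data.Nat.Properties using (_≤?_)
open import Relation.Binary.PropositionalEquality using (_≡_)
open import Function using (_∘_)
open import Function.Bundles using (_⇔_)

-- A set system on the ground set Fin m, given by its independent sets
-- (independence is decidable; classically every finite set system is).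
record IndepSystem (m : ℕ) : Set₁ where
  field
    Indep  : Subset m → Set
    indep? : ∀ S → Dec (Indep S)
open IndepSystem public

record Matroid (m : ℕ) : Set₁ where
  field
    system       : IndepSystem m
    empty-indep  : Indep system ⊥
    hereditary   : ∀ I J → J ⊆ I → Indep system I → Indep system J
    augmentation : ∀ I J → Indep system I → Indep system J → ∣ I ∣ < ∣ J ∣ →
                   ∃ λ x → x ∈ J × x ∉ I × Indep system (I ∪ ⁅ x ⁆)
open Matroid public

HasRank : ∀ {m} → IndepSystem m → Subset m → ℕ → Set
HasRank M S r = Σ (Subset _) λ I → I ⊆ S × Indep M I × ∣ I ∣ ≡ r ×
                 (∀ J → J ⊆ S → Indep M J → ∣ J ∣ ≤ r)

image : ∀ {m k} → (Fin m → Fin k) → Subset m → Subset k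
image {zero}  f []      = ⊥
image {suc m} f (b ∷ S) = (if b then ⁅ f zero ⁆ else ⊥) ∪ image (f ∘ suc) S

IsMorphism : ∀ {m k} → IndepSystem m → IndepSystem k → (Fin m → Fin k) → Set
IsMorphism M N f = ∀ S r → HasRank M S r ⇔ HasRank N (image f S) r

RankAtMost2 : ∀ {m} → Matroid m → Set
RankAtMost2 M = ∀ I → Indep (system M) I → ∣ I ∣ ≤ 2

-- U_{n,2} ⊕ T on ground set Fin (suc n) ≅ {0,…,n}: independent sets are
-- those with at most 2 elements not containing 0.
BigM-Indep : ∀ n → Subset (suc n) → Set
BigM-Indep n S = zero ∉ S × ∣ S ∣ ≤ 2

BigM : ∀ n → IndepSystem (suc n)
BigM n = record { Indep = BigM-Indep n
                ; indep? = λ S → ¬? (zero ∈? S) ×-dec (∣ S ∣ ≤? 2) }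

-- M' (on Fin m') is the prefix-restriction of M (on Fin (m' + suc j)),
-- the orderings being the identity orderings of Fin: a subset of the
-- first m' elements is independent in M' iff it is independent in M.
IsPrefixRestriction : ∀ {m' j} → Matroid m' → Matroid (m' + suc j) → Set
IsPrefixRestriction {m'} {j} M' M =
  ∀ S → Indep (system M') S ⇔ Indep (system M) (S ++ replicate (suc j) false)

InClass : ℕ → ∀ {m} → Matroid m → Set
InClass n {m} M = m ≤ n × RankAtMost2 M

Family : ℕ → Set₁
Family n = ∀ {m} (M : Matroid m) → InClass n M → Fin m → Fin (suc n)

IsOnlineMorphism : ∀ n → Family n → Set₁
IsOnlineMorphism n f =
  (∀ {m} (M : Matroid m) (c : InClass n M) → IsMorphism (system M) (BigM n) (f M c))
  × (∀ {m' j} (M' : Matroid m') (M : Matroid (m' + suc j))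
       (c' : InClass n M') (c : InClass n M) →
       IsPrefixRestriction M' M → ∀ x → f M' c' x ≡ f M c ((x ↑ˡ suc j)))

-- Send loops to the loop 0 and a non-loop x to 1 + the least element of its
-- parallel class.  On the non-loops of a matroid, "equal or forming a
-- dependent pair" is an equivalence relation (transitivity is the
-- augmentation axiom), so two non-loops get the same label iff they are
-- parallel.  In rank at most 2 the independent sets are ∅, non-loops and
-- non-parallel pairs of non-loops, so they correspond exactly to the
-- independent sets of U_{n,2} ⊕ T inside the image, and ranks are preserved.
-- The least element of the class of x comes no later than x, so the label of
-- x depends only on the prefix of the ordering ending at x.
{-# OPTIONS --safe #-}
module Submission where

open import Defs
open import Data.Nat as ℕ using (ℕ; _≤_; zero; suc; _+_; z≤n; s≤s)
import Data.Nat.Properties as ℕ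
open import Data.Bool using (true; false)
open import Data.Fin as Fin using (Fin; zero; suc; toℕ; inject≤; _↑ˡ_; _↑ʳ_; splitAt)
import Data.Fin.Properties as Fin
open import Data.Fin.Subset using (Subset; ⊥; ⁅_⁆; _∪_; _∈_; _⊆_; ∣_∣)
open import Data.Fin.Subset.Properties
  using (∉⊥; ⊥⊆; ∣⊥∣≡0; ∣⁅x⁆∣≡1; x∈⁅x⁆; x∈⁅y⁆⇒x≡y; ⊆-antisym; ∪-identityˡ; ∪-identityʳ;
         ∪-comm; p⊆p∪q; x≢y⇒x∉⁅y⁆; x∉⁅y⁆⇒x≢y; q⊆p∪q; x∈p∪q⁻; x∈p∪q⁺)
open import Data.Vec using ([]; _∷_; _++_; here; there)
open import Data.Vec.Properties using (zipWith-++)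
open import Data.Product using (Σ; _×_; _,_; ∃; proj₁; proj₂)
open import Data.Product.Function.NonDependent.Propositional using (_×-⇔_)
open import Data.Sum as Sum using (_⊎_; inj₁; inj₂)
open import Function using (_∘_)
open import Function.Bundles using (_⇔_; mk⇔; Equivalence)
import Level
open import Relation.Binary.PropositionalEquality
open import Relation.Nullary using (¬_; Dec; yes; no; contradiction)
open import Relation.Nullary.Decidable using (¬?; _×-dec_; _⊎-dec_; decidable-stable)
open import Relation.Unary using (Pred; Decidable; _≐_)

open Equivalence using (to; from)

private
  variable
    m k : ℕ

data AtMostTwo : Subset m → Set where
  empty     : AtMostTwo {m} ⊥
  singleton : (x : Fin m) → AtMostTwo ⁅ x ⁆
  pair      : {x y : Fin m} → x ≢ y → AtMostTwo (⁅ x ⁆ ∪ ⁅ y ⁆)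

∣⁅x⁆∪⁅y⁆∣≡2 : {x y : Fin m} → x ≢ y → ∣ ⁅ x ⁆ ∪ ⁅ y ⁆ ∣ ≡ 2
∣⁅x⁆∪⁅y⁆∣≡2 {x = zero}  {zero}  x≢y = contradiction refl x≢y
∣⁅x⁆∪⁅y⁆∣≡2 {x = zero}  {suc y} _   rewrite ∪-identityˡ ⁅ y ⁆ = cong suc (∣⁅x⁆∣≡1 y)
∣⁅x⁆∪⁅y⁆∣≡2 {x = suc x} {zero}  _   rewrite ∪-identityʳ ⁅ x ⁆ = cong suc (∣⁅x⁆∣≡1 x)
∣⁅x⁆∪⁅y⁆∣≡2 {x = suc x} {suc y} x≢y = ∣⁅x⁆∪⁅y⁆∣≡2 (x≢y ∘ cong suc)

atMostTwo : (S : Subset m) → ∣ S ∣ ≤ 2 → AtMostTwo S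
atMostTwo []          _ = empty
atMostTwo (false ∷ S) h with atMostTwo S h
... | empty       = empty
... | singleton x = singleton (suc x)
... | pair x≢y    = pair (x≢y ∘ Fin.suc-injective)
atMostTwo (true ∷ S)  h with atMostTwo S (ℕ.≤-trans (ℕ.n≤1+n _) h)
... | empty       = singleton zero
... | singleton y = subst AtMostTwo (cong (true ∷_) (∪-identityˡ ⁅ y ⁆)) (pair {x = zero} {suc y} λ ())
... | pair x≢y    with s≤s (s≤s ()) ← subst (λ s → suc s ≤ 2) (∣⁅x⁆∪⁅y⁆∣≡2 x≢y) h

⁅x⁆⊆ : {x : Fin m} {S : Subset m} → x ∈ S → ⁅ x ⁆ ⊆ S
⁅x⁆⊆ {S = S} x∈S y∈⁅x⁆ = subst (_∈ S) (sym (x∈⁅y⁆⇒x≡y _ y∈⁅x⁆)) x∈S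

∪⊆ : {p q S : Subset m} → p ⊆ S → q ⊆ S → p ∪ q ⊆ S
∪⊆ {p = p} {q} p⊆S q⊆S x∈p∪q = Sum.[ p⊆S , q⊆S ] (x∈p∪q⁻ p q x∈p∪q)

⊥++⊥ : ⊥ {m} ++ ⊥ {k} ≡ ⊥
⊥++⊥ {zero}  = refl
⊥++⊥ {suc m} = cong (false ∷_) (⊥++⊥ {m})

⁅x⁆++⊥ : (x : Fin m) → ⁅ x ⁆ ++ ⊥ {k} ≡ ⁅ x ↑ˡ k ⁆
⁅x⁆++⊥ {suc m} zero = cong (true ∷_) (⊥++⊥ {m})
⁅x⁆++⊥ (suc x)      = cong (false ∷_) (⁅x⁆++⊥ x)

∪-++-⊥ : (p q : Subset m) → (p ∪ q) ++ ⊥ {k} ≡ (p ++ ⊥) ∪ (q ++ ⊥)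
∪-++-⊥ p q = begin
  (p ∪ q) ++ ⊥         ≡⟨ cong ((p ∪ q) ++_) (sym (∪-identityˡ ⊥)) ⟩
  (p ∪ q) ++ (⊥ ∪ ⊥)   ≡⟨ sym (zipWith-++ _ p ⊥ q ⊥) ⟩
  (p ++ ⊥) ∪ (q ++ ⊥)  ∎
  where open ≡-Reasoning

∈-image⁺ : (f : Fin m → Fin k) {x : Fin m} {S : Subset m} → x ∈ S → f x ∈ image f S
∈-image⁺ f {S = true ∷ S} here      = x∈p∪q⁺ (inj₁ (x∈⁅x⁆ (f zero)))
∈-image⁺ f {S = _ ∷ S}    (there p) = x∈p∪q⁺ (inj₂ (∈-image⁺ (f ∘ suc) p))

∈-image⁻ : (f : Fin m → Fin k) (S : Subset m) {a : Fin k} → a ∈ image f S →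
           ∃ λ x → x ∈ S × f x ≡ a
∈-image⁻ f []      a∈ = contradiction a∈ ∉⊥
∈-image⁻ f (b ∷ S) a∈ with x∈p∪q⁻ _ (image (f ∘ suc) S) a∈
∈-image⁻ f (true ∷ S)  a∈ | inj₁ a∈⁅f0⁆ = zero , here , sym (x∈⁅y⁆⇒x≡y _ a∈⁅f0⁆)
∈-image⁻ f (false ∷ S) a∈ | inj₁ a∈⊥    = contradiction a∈⊥ ∉⊥
... | inj₂ a∈tail with ∈-image⁻ (f ∘ suc) S a∈tail
...   | x , x∈S , fx≡a = suc x , there x∈S , fx≡a

image-mono : (f : Fin m → Fin k) {S T : Subset m} → S ⊆ T → image f S ⊆ image f T
image-mono f {S} {T} S⊆T a∈ with ∈-image⁻ f S a∈
... | x , x∈S , refl = ∈-image⁺ f (S⊆T x∈S)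

image-⊥ : (f : Fin m → Fin k) → image f ⊥ ≡ ⊥
image-⊥ {zero}  f = refl
image-⊥ {suc m} f = trans (∪-identityˡ _) (image-⊥ (f ∘ suc))

image-⁅⁆ : (f : Fin m → Fin k) (x : Fin m) → image f ⁅ x ⁆ ≡ ⁅ f x ⁆
image-⁅⁆ f zero    = trans (cong (⁅ f zero ⁆ ∪_) (image-⊥ (f ∘ suc))) (∪-identityʳ _)
image-⁅⁆ f (suc x) = trans (∪-identityˡ _) (image-⁅⁆ (f ∘ suc) x)

image-∪ : (f : Fin m → Fin k) (p q : Subset m) → image f (p ∪ q) ≡ image f p ∪ image f q
image-∪ f p q = ⊆-antisym ⊆∪ (∪⊆ (image-mono f (p⊆p∪q q)) (image-mono f (q⊆p∪q p q)))
  where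
  ⊆∪ : image f (p ∪ q) ⊆ image f p ∪ image f q
  ⊆∪ a∈ with ∈-image⁻ f (p ∪ q) a∈
  ... | x , x∈p∪q , refl = x∈p∪q⁺ (Sum.map (∈-image⁺ f) (∈-image⁺ f) (x∈p∪q⁻ p q x∈p∪q))

module _ (M : IndepSystem m) (N : IndepSystem k) (f : Fin m → Fin k) where

  PreservesIndependence : Set
  PreservesIndependence =
    ∀ I → Indep M I → Indep N (image f I) × ∣ image f I ∣ ≡ ∣ I ∣

  LiftsIndependence : Set
  LiftsIndependence =
    ∀ S J → J ⊆ image f S → Indep N J → ∃ λ I → I ⊆ S × Indep M I × ∣ I ∣ ≡ ∣ J ∣

  preserves∧lifts⇒isMorphism : PreservesIndependence → LiftsIndependence → IsMorphism M N f
  preserves∧lifts⇒isMorphism preserves lifts S r = mk⇔ rank-image rank-preimage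
    where
    rank-image : HasRank M S r → HasRank N (image f S) r
    rank-image (I , I⊆S , I-ind , ∣I∣≡r , I-max) =
      image f I , image-mono f I⊆S , proj₁ (preserves I I-ind) ,
      trans (proj₂ (preserves I I-ind)) ∣I∣≡r ,
      λ J J⊆ J-ind → let (I′ , I′⊆S , I′-ind , ∣I′∣≡∣J∣) = lifts S J J⊆ J-ind in
        subst (_≤ r) ∣I′∣≡∣J∣ (I-max I′ I′⊆S I′-ind)

    rank-preimage : HasRank N (image f S) r → HasRank M S r
    rank-preimage (J , J⊆ , J-ind , ∣J∣≡r , J-max) =
      let (I , I⊆S , I-ind , ∣I∣≡∣J∣) = lifts S J J⊆ J-ind in
      I , I⊆S , I-ind , trans ∣I∣≡∣J∣ ∣J∣≡r ,
      λ I′ I′⊆S I′-ind → let (fI′-ind , ∣fI′∣≡∣I′∣) = preserves I′ I′-ind in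
        subst (_≤ r) ∣fI′∣≡∣I′∣ (J-max (image f I′) (image-mono f I′⊆S) fI′-ind)

bigM-⊥ : ∀ n → BigM-Indep n ⊥
bigM-⊥ n = ∉⊥ , subst (_≤ 2) (sym (∣⊥∣≡0 (suc n))) z≤n

bigM-⁅⁆ : ∀ {n} {a : Fin (suc n)} → a ≢ zero → BigM-Indep n ⁅ a ⁆
bigM-⁅⁆ {a = a} a≢0 = x≢y⇒x∉⁅y⁆ (≢-sym a≢0) , subst (_≤ 2) (sym (∣⁅x⁆∣≡1 a)) (s≤s z≤n)

bigM-pair : ∀ {n} {a b : Fin (suc n)} → a ≢ zero → b ≢ zero → a ≢ b →
            BigM-Indep n (⁅ a ⁆ ∪ ⁅ b ⁆)
bigM-pair {a = a} {b} a≢0 b≢0 a≢b =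
  (λ 0∈ab → Sum.[ x≢y⇒x∉⁅y⁆ (≢-sym a≢0) , x≢y⇒x∉⁅y⁆ (≢-sym b≢0) ] (x∈p∪q⁻ ⁅ a ⁆ ⁅ b ⁆ 0∈ab)) ,
  subst (_≤ 2) (sym (∣⁅x⁆∪⁅y⁆∣≡2 a≢b)) ℕ.≤-refl

Least : {ℓ : Level.Level} → Pred (Fin m) ℓ → Fin m → Set ℓ
Least P i = P i × (∀ {j} → P j → i Fin.≤ j)

least : {ℓ : Level.Level} {P : Pred (Fin m) ℓ} → Decidable P → {x : Fin m} → P x → ∃ (Least P)
least {suc m} P? px with P? zero
least {suc m} P? px         | yes p0 = zero , p0 , λ _ → z≤n
least {suc m} P? {zero} px  | no ¬p0 = contradiction px ¬p0
least {suc m} {P = P} P? {suc x} px | no ¬p0 with least (P? ∘ suc) px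
... | i , pi , i-least = suc i , pi , suc-i-least
  where
  suc-i-least : ∀ {j} → P j → suc i Fin.≤ j
  suc-i-least {zero}  p0 = contradiction p0 ¬p0
  suc-i-least {suc j} pj = s≤s (i-least pj)

least-unique : {ℓ : Level.Level} {P : Pred (Fin m) ℓ} {i j : Fin m} →
               Least P i → Least P j → i ≡ j
least-unique (pi , i-least) (pj , j-least) = Fin.≤-antisym (i-least pj) (j-least pi)

least-cong : {ℓ₁ ℓ₂ : Level.Level} {P : Pred (Fin m) ℓ₁} {Q : Pred (Fin m) ℓ₂} {i : Fin m} →
             P ≐ Q → Least P i → Least Q i
least-cong (P⊆Q , Q⊆P) (pi , i-least) = P⊆Q pi , i-least ∘ Q⊆P

least-↑ˡ : {ℓ₁ ℓ₂ : Level.Level} {P : Pred (Fin m) ℓ₁} {Q : Pred (Fin (m + k)) ℓ₂} {i : Fin m} →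
           P ≐ Q ∘ (_↑ˡ k) → Least P i → Least Q (i ↑ˡ k)
least-↑ˡ {m} {k} {Q = Q} {i} (P⊆Q , Q⊆P) (pi , i-least) = P⊆Q pi , below
  where
  open ℕ.≤-Reasoning
  below : ∀ {j} → Q j → i ↑ˡ k Fin.≤ j
  below {j} qj with splitAt m j in split
  ... | inj₁ j′ rewrite sym (Fin.splitAt⁻¹-↑ˡ split) = begin
    toℕ (i ↑ˡ k)   ≡⟨ Fin.toℕ-↑ˡ i k ⟩
    toℕ i          ≤⟨ i-least (Q⊆P qj) ⟩
    toℕ j′         ≡⟨ Fin.toℕ-↑ˡ j′ k ⟨
    toℕ (j′ ↑ˡ k)  ∎
  ... | inj₂ j′ rewrite sym (Fin.splitAt⁻¹-↑ʳ split) = begin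
    toℕ (i ↑ˡ k)   ≡⟨ Fin.toℕ-↑ˡ i k ⟩
    toℕ i          ≤⟨ ℕ.<⇒≤ (Fin.toℕ<n i) ⟩
    m              ≤⟨ ℕ.m≤m+n m _ ⟩
    m + toℕ j′     ≡⟨ Fin.toℕ-↑ʳ m j′ ⟨
    toℕ (m ↑ʳ j′)  ∎

module _ (M : Matroid m) where

  private
    Ind : Subset m → Set
    Ind = Indep (system M)

  NonLoop : Pred (Fin m) Level.0ℓ
  NonLoop x = Ind ⁅ x ⁆

  nonLoop? : Decidable NonLoop
  nonLoop? x = indep? (system M) ⁅ x ⁆

  Parallel : Fin m → Fin m → Set
  Parallel x y = x ≡ y ⊎ ¬ Ind (⁅ x ⁆ ∪ ⁅ y ⁆)

  parallel? : ∀ x y → Dec (Parallel x y)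
  parallel? x y = (x Fin.≟ y) ⊎-dec ¬? (indep? (system M) (⁅ x ⁆ ∪ ⁅ y ⁆))

  parallel-sym : ∀ {x y} → Parallel x y → Parallel y x
  parallel-sym (inj₁ x≡y) = inj₁ (sym x≡y)
  parallel-sym {x} {y} (inj₂ dep) = inj₂ (dep ∘ subst Ind (∪-comm ⁅ y ⁆ ⁅ x ⁆))

  -- Augmenting {y} from an independent pair {x, z} would make y independent of x or of z.
  parallel-trans : ∀ {x y z} → NonLoop y → Parallel x y → Parallel y z → Parallel x z
  parallel-trans _ (inj₁ refl) y∥z = y∥z
  parallel-trans _ x∥y (inj₁ refl) = x∥y
  parallel-trans {x} {y} {z} y-nl (inj₂ x∦y) (inj₂ y∦z)
    with x Fin.≟ z | indep? (system M) (⁅ x ⁆ ∪ ⁅ z ⁆)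
  ... | yes x≡z | _       = inj₁ x≡z
  ... | no _    | no dep  = inj₂ dep
  ... | no x≢z  | yes ind
    with augmentation M ⁅ y ⁆ (⁅ x ⁆ ∪ ⁅ z ⁆) y-nl ind
           (subst₂ ℕ._<_ (sym (∣⁅x⁆∣≡1 y)) (sym (∣⁅x⁆∪⁅y⁆∣≡2 x≢z)) (s≤s (s≤s z≤n)))
  ... | w , w∈xz , _ , yw-ind with x∈p∪q⁻ ⁅ x ⁆ ⁅ z ⁆ w∈xz
  ...   | inj₁ w∈⁅x⁆ rewrite x∈⁅y⁆⇒x≡y x w∈⁅x⁆ =
          contradiction (subst Ind (∪-comm ⁅ y ⁆ ⁅ x ⁆) yw-ind) x∦y
  ...   | inj₂ w∈⁅z⁆ rewrite x∈⁅y⁆⇒x≡y z w∈⁅z⁆ = contradiction yw-ind y∦z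

  ¬parallel⇒indep : ∀ {x y} → ¬ Parallel x y → x ≢ y × Ind (⁅ x ⁆ ∪ ⁅ y ⁆)
  ¬parallel⇒indep x∦y = x∦y ∘ inj₁ , decidable-stable (indep? (system M) _) (x∦y ∘ inj₂)

  ParallelClass : Fin m → Pred (Fin m) Level.0ℓ
  ParallelClass x y = NonLoop y × Parallel y x

  parallelClass-cong : ∀ {x y} → NonLoop x → NonLoop y → Parallel x y →
                       ParallelClass x ≐ ParallelClass y
  parallelClass-cong x-nl y-nl x∥y =
    (λ (z-nl , z∥x) → z-nl , parallel-trans x-nl z∥x x∥y) ,
    (λ (z-nl , z∥y) → z-nl , parallel-trans y-nl z∥y (parallel-sym x∥y))

  parallelClass? : ∀ x → Decidable (ParallelClass x)
  parallelClass? x y = nonLoop? y ×-dec parallel? y x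

  representative : ∀ x → NonLoop x → Fin m
  representative x x-nl = proj₁ (least (parallelClass? x) {x} (x-nl , inj₁ refl))

  representative-least : ∀ {x} (x-nl : NonLoop x) →
                         Least (ParallelClass x) (representative x x-nl)
  representative-least {x} x-nl = proj₂ (least (parallelClass? x) {x} (x-nl , inj₁ refl))

  representative-≡⇔parallel : ∀ {x y} (x-nl : NonLoop x) (y-nl : NonLoop y) →
    representative x x-nl ≡ representative y y-nl ⇔ Parallel x y
  representative-≡⇔parallel x-nl y-nl = mk⇔
    (λ rx≡ry →
       let (r-nl , r∥x) = proj₁ (representative-least x-nl)
           r∥y = subst (λ r → Parallel r _) (sym rx≡ry) (proj₂ (proj₁ (representative-least y-nl)))
       in parallel-trans r-nl (parallel-sym r∥x) r∥y)
    (λ x∥y → least-unique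
       (least-cong (parallelClass-cong x-nl y-nl x∥y) (representative-least x-nl))
       (representative-least y-nl))

  module _ {n} (m≤n : m ≤ n) where

    label : Fin m → Fin (suc n)
    label x with nonLoop? x
    ... | yes x-nl = suc (inject≤ (representative x x-nl) m≤n)
    ... | no _     = zero

    label-loop : ∀ {x} → ¬ NonLoop x → label x ≡ zero
    label-loop {x} loop with nonLoop? x
    ... | yes x-nl = contradiction x-nl loop
    ... | no _     = refl

    label-nonLoop : ∀ {x} (x-nl : NonLoop x) →
                    label x ≡ suc (inject≤ (representative x x-nl) m≤n)
    label-nonLoop {x} x-nl with nonLoop? x
    ... | yes x-nl′ = cong (λ r → suc (inject≤ r m≤n))
                           (representative-≡⇔parallel x-nl′ x-nl .from (inj₁ refl))
    ... | no loop   = contradiction x-nl loop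

    label-nonLoop-≢zero : ∀ {x} → NonLoop x → label x ≢ zero
    label-nonLoop-≢zero x-nl eq with () ← trans (sym (label-nonLoop x-nl)) eq

    label-≢zero⇒nonLoop : ∀ {x} → label x ≢ zero → NonLoop x
    label-≢zero⇒nonLoop {x} lx≢0 = decidable-stable (nonLoop? x) (lx≢0 ∘ label-loop)

    label-≡⇔parallel : ∀ {x y} → NonLoop x → NonLoop y → label x ≡ label y ⇔ Parallel x y
    label-≡⇔parallel {x} {y} x-nl y-nl = mk⇔
      (λ lx≡ly → representative-≡⇔parallel x-nl y-nl .to
         (Fin.inject≤-injective m≤n m≤n _ _ (Fin.suc-injective
           (trans (sym (label-nonLoop x-nl)) (trans lx≡ly (label-nonLoop y-nl))))))
      (λ x∥y → begin
         label x                                      ≡⟨ label-nonLoop x-nl ⟩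
         suc (inject≤ (representative x x-nl) m≤n)    ≡⟨ cong (λ r → suc (inject≤ r m≤n))
                                                           (representative-≡⇔parallel x-nl y-nl .from x∥y) ⟩
         suc (inject≤ (representative y y-nl) m≤n)    ≡⟨ label-nonLoop y-nl ⟨
         label y                                      ∎)
      where open ≡-Reasoning

    label-preservesIndependence : RankAtMost2 M → PreservesIndependence (system M) (BigM n) label
    label-preservesIndependence rank≤2 I I-ind with atMostTwo I (rank≤2 I I-ind)
    ... | empty rewrite image-⊥ label =
          bigM-⊥ n , trans (∣⊥∣≡0 (suc n)) (sym (∣⊥∣≡0 m))
    ... | singleton x rewrite image-⁅⁆ label x =
          bigM-⁅⁆ (label-nonLoop-≢zero I-ind) , trans (∣⁅x⁆∣≡1 (label x)) (sym (∣⁅x⁆∣≡1 x))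
    ... | pair {x = x} {y} x≢y rewrite image-∪ label ⁅ x ⁆ ⁅ y ⁆ | image-⁅⁆ label x | image-⁅⁆ label y =
          bigM-pair (label-nonLoop-≢zero x-nl) (label-nonLoop-≢zero y-nl) lx≢ly ,
          trans (∣⁅x⁆∪⁅y⁆∣≡2 lx≢ly) (sym (∣⁅x⁆∪⁅y⁆∣≡2 x≢y))
      where
      x-nl : NonLoop x
      x-nl = hereditary M _ ⁅ x ⁆ (p⊆p∪q ⁅ y ⁆) I-ind
      y-nl : NonLoop y
      y-nl = hereditary M _ ⁅ y ⁆ (q⊆p∪q ⁅ x ⁆ ⁅ y ⁆) I-ind
      lx≢ly : label x ≢ label y
      lx≢ly lx≡ly = Sum.[ x≢y , (λ dep → dep I-ind) ] (label-≡⇔parallel x-nl y-nl .to lx≡ly)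

    label-liftsIndependence : LiftsIndependence (system M) (BigM n) label
    label-liftsIndependence S J J⊆ (0∉J , ∣J∣≤2) with atMostTwo J ∣J∣≤2
    ... | empty = ⊥ , ⊥⊆ , empty-indep M , trans (∣⊥∣≡0 m) (sym (∣⊥∣≡0 (suc n)))
    ... | singleton a with ∈-image⁻ label S (J⊆ (x∈⁅x⁆ a))
    ...   | x , x∈S , refl =
            ⁅ x ⁆ , ⁅x⁆⊆ x∈S , label-≢zero⇒nonLoop (≢-sym (x∉⁅y⁆⇒x≢y 0∉J)) ,
            trans (∣⁅x⁆∣≡1 x) (sym (∣⁅x⁆∣≡1 (label x)))
    label-liftsIndependence S J J⊆ (0∉J , ∣J∣≤2) | pair {x = a} {b} a≢b
      with ∈-image⁻ label S (J⊆ (x∈p∪q⁺ (inj₁ (x∈⁅x⁆ a))))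
         | ∈-image⁻ label S (J⊆ (x∈p∪q⁺ (inj₂ (x∈⁅x⁆ b))))
    ... | x , x∈S , refl | y , y∈S , refl =
          ⁅ x ⁆ ∪ ⁅ y ⁆ , ∪⊆ (⁅x⁆⊆ x∈S) (⁅x⁆⊆ y∈S) , proj₂ independent-pair ,
          trans (∣⁅x⁆∪⁅y⁆∣≡2 (proj₁ independent-pair)) (sym (∣⁅x⁆∪⁅y⁆∣≡2 a≢b))
      where
      x-nl : NonLoop x
      x-nl = label-≢zero⇒nonLoop (≢-sym (x∉⁅y⁆⇒x≢y (0∉J ∘ x∈p∪q⁺ ∘ inj₁)))
      y-nl : NonLoop y
      y-nl = label-≢zero⇒nonLoop (≢-sym (x∉⁅y⁆⇒x≢y (0∉J ∘ x∈p∪q⁺ ∘ inj₂)))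
      independent-pair : x ≢ y × Ind (⁅ x ⁆ ∪ ⁅ y ⁆)
      independent-pair = ¬parallel⇒indep (a≢b ∘ label-≡⇔parallel x-nl y-nl .from)

    label-isMorphism : RankAtMost2 M → IsMorphism (system M) (BigM n) label
    label-isMorphism rank≤2 = preserves∧lifts⇒isMorphism (system M) (BigM n) label
      (label-preservesIndependence rank≤2) label-liftsIndependence

inject≤-↑ˡ : ∀ {n} (i : Fin m) .(m≤n : m ≤ n) .(m+k≤n : m + k ≤ n) →
             inject≤ i m≤n ≡ inject≤ (i ↑ˡ k) m+k≤n
inject≤-↑ˡ {k = k} i m≤n m+k≤n = Fin.toℕ-injective (begin
  toℕ (inject≤ i m≤n)           ≡⟨ Fin.toℕ-inject≤ i m≤n ⟩
  toℕ i                         ≡⟨ Fin.toℕ-↑ˡ i k ⟨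
  toℕ (i ↑ˡ k)                  ≡⟨ Fin.toℕ-inject≤ (i ↑ˡ k) m+k≤n ⟨
  toℕ (inject≤ (i ↑ˡ k) m+k≤n)  ∎)
  where open ≡-Reasoning

module _ {m′ j} (M′ : Matroid m′) (M : Matroid (m′ + suc j))
         (prefix : IsPrefixRestriction M′ M) where

  private
    indep-↑ˡ : ∀ S {T} → S ++ ⊥ ≡ T → Indep (system M′) S ⇔ Indep (system M) T
    indep-↑ˡ S S++⊥≡T = subst (λ T → Indep (system M′) S ⇔ Indep (system M) T) S++⊥≡T (prefix S)

  nonLoop-↑ˡ : ∀ {x} → NonLoop M′ x ⇔ NonLoop M (x ↑ˡ suc j)
  nonLoop-↑ˡ {x} = indep-↑ˡ ⁅ x ⁆ (⁅x⁆++⊥ x)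

  parallel-↑ˡ : ∀ {x y} → Parallel M′ x y ⇔ Parallel M (x ↑ˡ suc j) (y ↑ˡ suc j)
  parallel-↑ˡ {x} {y} = mk⇔
    (Sum.map (cong (_↑ˡ suc j)) (λ dep → dep ∘ pair-indep .from))
    (Sum.map (Fin.↑ˡ-injective (suc j) x y) (λ dep → dep ∘ pair-indep .to))
    where
    pair-indep : Indep (system M′) (⁅ x ⁆ ∪ ⁅ y ⁆) ⇔ Indep (system M) (⁅ x ↑ˡ suc j ⁆ ∪ ⁅ y ↑ˡ suc j ⁆)
    pair-indep = indep-↑ˡ (⁅ x ⁆ ∪ ⁅ y ⁆)
      (trans (∪-++-⊥ ⁅ x ⁆ ⁅ y ⁆) (cong₂ _∪_ (⁅x⁆++⊥ x) (⁅x⁆++⊥ y)))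

  parallelClass-↑ˡ : ∀ {x} → ParallelClass M′ x ≐ ParallelClass M (x ↑ˡ suc j) ∘ (_↑ˡ suc j)
  parallelClass-↑ˡ = (nonLoop-↑ˡ ×-⇔ parallel-↑ˡ) .to , (nonLoop-↑ˡ ×-⇔ parallel-↑ˡ) .from

  representative-↑ˡ : ∀ {x} (x-nl′ : NonLoop M′ x) (x-nl : NonLoop M (x ↑ˡ suc j)) →
    representative M (x ↑ˡ suc j) x-nl ≡ representative M′ x x-nl′ ↑ˡ suc j
  representative-↑ˡ x-nl′ x-nl = least-unique
    (representative-least M x-nl)
    (least-↑ˡ parallelClass-↑ˡ (representative-least M′ x-nl′))

  label-↑ˡ : ∀ {n} (m′≤n : m′ ≤ n) (m≤n : m′ + suc j ≤ n) x →
             label M′ m′≤n x ≡ label M m≤n (x ↑ˡ suc j)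
  label-↑ˡ m′≤n m≤n x with nonLoop? M′ x
  ... | no loop   = sym (label-loop M m≤n (loop ∘ nonLoop-↑ˡ .from))
  ... | yes x-nl′ = begin
    suc (inject≤ (representative M′ x x-nl′) m′≤n)         ≡⟨ cong suc (inject≤-↑ˡ _ m′≤n m≤n) ⟩
    suc (inject≤ (representative M′ x x-nl′ ↑ˡ suc j) m≤n) ≡⟨ cong (λ r → suc (inject≤ r m≤n))
                                                               (representative-↑ˡ x-nl′ x-nl) ⟨
    suc (inject≤ (representative M (x ↑ˡ suc j) x-nl) m≤n) ≡⟨ label-nonLoop M m≤n x-nl ⟨
    label M m≤n (x ↑ˡ suc j)                              ∎
    where
    open ≡-Reasoning
    x-nl : NonLoop M (x ↑ˡ suc j)
    x-nl = nonLoop-↑ˡ .to x-nl′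

lemma11 : (n : ℕ) → 1 ≤ n → Σ (Family n) (IsOnlineMorphism n)
lemma11 n _ = family , isMorphism , isOnline
  where
  family : Family n
  family M (m≤n , _) = label M m≤n

  isMorphism : ∀ {m} (M : Matroid m) (c : InClass n M) → IsMorphism (system M) (BigM n) (family M c)
  isMorphism M (m≤n , rank≤2) = label-isMorphism M m≤n rank≤2

  isOnline : ∀ {m′ j} (M′ : Matroid m′) (M : Matroid (m′ + suc j)) (c′ : InClass n M′) (c : InClass n M) →
             IsPrefixRestriction M′ M → ∀ x → family M′ c′ x ≡ family M c (x ↑ˡ suc j)
  isOnline M′ M (m′≤n , _) (m≤n , _) prefix = label-↑ˡ M′ M prefix m′≤n m≤n
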